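{- A rooted labeled forest that avoids the pattern $132$ avoids the pattern $3124$ if and only if it is a $P_2$-forest.
   Context: Rooted labeled forest: an unordered forest whose components have distinguished roots and whose vertices carry distinct integer labels $L(v)$. An instance of a pattern $\pi$ of length $k$ (a permutation of $[k]$) is a sequence $v_1,\dots,v_k$ with $v_i$ a strict ancestor of $v_{i+1}$ and labels in the same relative order as $\pi$; avoiding means having no instance. Ancestors of $v$ include $v$. A vertex $v$ is a top-down minimum (TDM) if $L(u)\ge L(v)$ for all ancestors $u$ of $v$; otherwise non-TDM. For a non-TDM vertex $v$, its segment is the set of TDM ancestors $u$ of $v$ with $L(u)<L(v)$; the top of $v$ (of its segment) is the vertex of the segment closest to the root, equivalently the one with the greatest label. Two vertices are comparable if one is an ancestor of the other. A $P_2$-forest is a forest in which, whenever two comparable non-TDM vertices have intersecting segments, their tops coincide. -}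

module Defs where

open import Data.Nat using (ℕ; suc) renaming (_<_ to _<ℕ_)
open import Data.Fin using (Fin; inject₁) renaming (suc to fsuc)
open import Data.Integer using (ℤ; _<_; _≤_)
open import Data.Maybe using (Maybe; just; nothing)
open import Data.Product using (Σ; _×_; ∃-syntax)
open import Data.Sum using (_⊎_)
open import Data.Vec using (Vec; lookup; _∷_; [])
open import Relation.Nullary using (¬_)
open import Relation.Binary.PropositionalEquality using (_≡_)
open import Function.Definitions using (Injective)

-- A rooted labeled forest on the vertex set Fin n, given by a parent map
-- (roots have parent nothing), an injective integer labelling, and an
-- acyclicity witness (a depth function strictly increasing from parent to child).
record Forest (n : ℕ) : Set where
  field
    parent    : Fin n → Maybe (Fin n)
    label     : Fin n → ℤ
    label-inj : Injective _≡_ _≡_ label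
    acyclic   : Σ (Fin n → ℕ) λ depth →
                  ∀ v p → parent v ≡ just p → depth p <ℕ depth v

module _ {n : ℕ} (F : Forest n) where
  open Forest F

  data _≼_ (u : Fin n) : Fin n → Set where
    here  : u ≼ u
    there : ∀ {v p} → parent v ≡ just p → u ≼ p → u ≼ v

  _≺_ : Fin n → Fin n → Set
  u ≺ v = ∃[ p ] (parent v ≡ just p × u ≼ p)

  -- an instance of the pattern π (entries listed as natural numbers;
  -- a permutation of [k] is given as the vector (π(1),…,π(k)))
  IsInstance : ∀ {m} → Vec ℕ (suc m) → (Fin (suc m) → Fin n) → Set
  IsInstance {m} π v =
      (∀ (i : Fin m) → v (inject₁ i) ≺ v (fsuc i))
    × (∀ i j → (lookup π i <ℕ lookup π j → label (v i) < label (v j))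
             × (label (v i) < label (v j) → lookup π i <ℕ lookup π j))

  Contains : ∀ {m} → Vec ℕ (suc m) → Set
  Contains {m} π = ∃[ v ] IsInstance π v

  Avoids : ∀ {m} → Vec ℕ (suc m) → Set
  Avoids π = ¬ Contains π

  TDM : Fin n → Set
  TDM v = ∀ u → u ≼ v → label v ≤ label u

  InSegment : Fin n → Fin n → Set
  InSegment v u = u ≼ v × TDM u × label u < label v

  IsTop : Fin n → Fin n → Set
  IsTop v t = InSegment v t × (∀ u → InSegment v u → t ≼ u)

  Comparable : Fin n → Fin n → Set
  Comparable v w = v ≼ w ⊎ w ≼ v

  P₂ : Set
  P₂ = ∀ v w → Comparable v w → ¬ TDM v → ¬ TDM w →
         (∃[ u ] (InSegment v u × InSegment w u)) →
         ∀ t t' → IsTop v t → IsTop w t' → t ≡ t'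

p132 : Vec ℕ 3
p132 = 1 ∷ 3 ∷ 2 ∷ []

p3124 : Vec ℕ 4
p3124 = 3 ∷ 1 ∷ 2 ∷ 4 ∷ []

module Submission where

-- The rootmost ancestor of x with label below c is a top-down minimum; this
-- produces segment vertices and tops. Let v ≼ w be non-TDM with a common segment
-- vertex and tops t, t′; both lie above that vertex, hence are comparable. If
-- t ≺ t′, then t is not in the segment of w (else t′ ≼ t), so L w < L t and
-- t′, v, w is a 132; if t′ ≺ t, then t′ is not in the segment of v, so L v < L t′
-- and t′, t, v, w is a 3124. Conversely, if a, b, c, d is a 3124, the rootmost
-- ancestor of b with label below L c lies in the segments of c and of d, so in a
-- P₂-forest c and d have a common top T; since some segment vertex of d lies
-- above a, T ≺ a, and T, a, c is a 132.

open import Defs using (Forest; Avoids; P₂; p132; p3124; here; there)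
import Defs
open import Data.Bool using (T)
open import Data.Empty using (⊥-elim)
open import Data.Fin using (Fin; zero; suc; inject₁)
open import Data.Integer using (ℤ; _<_; _<?_)
import Data.Integer.Properties as ℤ
open import Data.Maybe using (just; nothing)
open import Data.Nat using (ℕ; suc; _<ᵇ_; _≟_) renaming (_<_ to _<ℕ_; _≤_ to _≤ℕ_)
import Data.Nat.Properties as ℕ
open import Data.Nat.Induction using (<-wellFounded)
open import Data.Product using (_×_; _,_; proj₁; proj₂; ∃; ∃-syntax)
open import Data.Sum using (_⊎_; inj₁; inj₂)
open import Data.Vec using (Vec; lookup; _∷_; [])
open import Data.Vec.Relation.Unary.AllPairs using (allPairs?)
open import Data.Vec.Relation.Unary.Unique.Propositional using (Unique)
open import Data.Vec.Relation.Unary.Unique.Propositional.Properties using (lookup-injective)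
open import Function.Bundles using (_⇔_; mk⇔)
open import Induction.WellFounded using (WellFounded; module Subrelation; module All)
import Relation.Binary.Construct.On as On
open import Relation.Binary.Definitions using (tri<; tri≈; tri>)
open import Relation.Binary.PropositionalEquality using (_≡_; _≢_; refl; sym; trans; subst)
open import Relation.Nullary using (¬_; yes; no)
open import Relation.Nullary.Decidable using (from-yes; ¬?)
open import Relation.Unary using (Decidable)

module _ {n : ℕ} (F : Forest n) where
  open Forest F

  infix 4 _≼_ _≺_

  _≼_ _≺_ : Fin n → Fin n → Set
  _≼_ = Defs._≼_ F
  _≺_ = Defs._≺_ F

  TDM : Fin n → Set
  TDM = Defs.TDM F

  InSegment IsTop Comparable : Fin n → Fin n → Set
  InSegment = Defs.InSegment F
  IsTop = Defs.IsTop F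
  Comparable = Defs.Comparable F

  Contains : ∀ {m} → Vec ℕ (suc m) → Set
  Contains = Defs.Contains F

  ≺⇒≼ : ∀ {u v} → u ≺ v → u ≼ v
  ≺⇒≼ (_ , e , u≼p) = there e u≼p

  ≼-trans : ∀ {u v w} → u ≼ v → v ≼ w → u ≼ w
  ≼-trans u≼v here = u≼v
  ≼-trans u≼v (there e v≼p) = there e (≼-trans u≼v v≼p)

  ≺-trans : ∀ {u v w} → u ≺ v → v ≺ w → u ≺ w
  ≺-trans u≺v (p , e , v≼p) = p , e , ≼-trans (≺⇒≼ u≺v) v≼p

  ≼∧≢⇒≺ : ∀ {u v} → u ≼ v → u ≢ v → u ≺ v
  ≼∧≢⇒≺ here u≢u = ⊥-elim (u≢u refl)
  ≼∧≢⇒≺ (there e u≼p) _ = _ , e , u≼p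

  depth : Fin n → ℕ
  depth = proj₁ acyclic

  ≼⇒depth≤ : ∀ {u v} → u ≼ v → depth u ≤ℕ depth v
  ≼⇒depth≤ here = ℕ.≤-refl
  ≼⇒depth≤ (there e u≼p) = ℕ.≤-trans (≼⇒depth≤ u≼p) (ℕ.<⇒≤ (proj₂ acyclic _ _ e))

  ≺⇒depth< : ∀ {u v} → u ≺ v → depth u <ℕ depth v
  ≺⇒depth< (_ , e , u≼p) = ℕ.≤-<-trans (≼⇒depth≤ u≼p) (proj₂ acyclic _ _ e)

  ≺-wellFounded : WellFounded _≺_
  ≺-wellFounded = Subrelation.wellFounded ≺⇒depth< (On.wellFounded depth <-wellFounded)

  ≼-antisym : ∀ {u v} → u ≼ v → v ≼ u → u ≡ v
  ≼-antisym here _ = refl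
  ≼-antisym (there e u≼p) v≼u = ⊥-elim (ℕ.≤⇒≯ (≼⇒depth≤ v≼u) (≺⇒depth< (_ , e , u≼p)))

  ≼-root : ∀ {u x} → parent x ≡ nothing → u ≼ x → u ≡ x
  ≼-root _ here = refl
  ≼-root e (there e′ _) with () ← trans (sym e) e′

  ≼-parent : ∀ {u x p} → parent x ≡ just p → u ≼ x → u ≡ x ⊎ u ≼ p
  ≼-parent _ here = inj₁ refl
  ≼-parent e (there e′ u≼p) with refl ← trans (sym e) e′ = inj₂ u≼p

  ancestors-comparable : ∀ {u w x} → u ≼ x → w ≼ x → Comparable u w
  ancestors-comparable here w≼x = inj₂ w≼x
  ancestors-comparable u≼x here = inj₁ u≼x
  ancestors-comparable (there e u≼p) (there e′ w≼p′) with refl ← trans (sym e) e′ =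
    ancestors-comparable u≼p w≼p′

  Rootmost : (Fin n → Set) → Fin n → Fin n → Set
  Rootmost P x t = t ≼ x × P t × (∀ {u} → u ≼ x → P u → t ≼ u)

  module _ {P : Fin n → Set} (P? : Decidable P) where

    Search : Fin n → Set
    Search x = (∀ {u} → u ≼ x → ¬ P u) ⊎ ∃ (Rootmost P x)

    search-root : ∀ {x} → parent x ≡ nothing → Search x
    search-root {x} e with P? x
    ... | yes Px = inj₂ (x , here , Px , λ u≼x _ → subst (x ≼_) (sym (≼-root e u≼x)) here)
    ... | no ¬Px = inj₁ (λ u≼x Pu → ¬Px (subst P (≼-root e u≼x) Pu))

    search-child : ∀ {x p} → parent x ≡ just p → Search p → Search x
    search-child {x} e (inj₂ (t , t≼p , Pt , least)) = inj₂ (t , there e t≼p , Pt , least′)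
      where
      least′ : ∀ {u} → u ≼ x → P u → t ≼ u
      least′ u≼x Pu with ≼-parent e u≼x
      ... | inj₁ refl = there e t≼p
      ... | inj₂ u≼p = least u≼p Pu
    search-child {x} e (inj₁ none-above) with P? x
    ... | yes Px = inj₂ (x , here , Px , x≼)
      where
      x≼ : ∀ {u} → u ≼ x → P u → x ≼ u
      x≼ u≼x Pu with ≼-parent e u≼x
      ... | inj₁ refl = here
      ... | inj₂ u≼p = ⊥-elim (none-above u≼p Pu)
    ... | no ¬Px = inj₁ none
      where
      none : ∀ {u} → u ≼ x → ¬ P u
      none u≼x Pu with ≼-parent e u≼x
      ... | inj₁ refl = ¬Px Pu
      ... | inj₂ u≼p = none-above u≼p Pu

    search : ∀ x → Search x
    search = All.wfRec ≺-wellFounded _ Search step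
      where
      step : ∀ x → (∀ {y} → y ≺ x → Search y) → Search x
      step x ih with parent x in e
      ... | nothing = search-root e
      ... | just p = search-child e (ih (p , refl , here))

    rootmost : ∀ {u x} → u ≼ x → P u → ∃ (Rootmost P x)
    rootmost {x = x} u≼x Pu with search x
    ... | inj₁ none = ⊥-elim (none u≼x Pu)
    ... | inj₂ found = found

  Below : ℤ → Fin n → Set
  Below c w = label w < c

  rootmost-below-is-TDM : ∀ {c x t} → Rootmost (Below c) x t → TDM t
  rootmost-below-is-TDM {t = t} (t≼x , t<c , least) u u≼t = ℤ.≮⇒≥ u≮t
    where
    u≮t : ¬ label u < label t
    u≮t u<t with ≼-antisym u≼t (least (≼-trans u≼t t≼x) (ℤ.<-trans u<t t<c))
    ... | refl = ℤ.<-irrefl refl u<t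

  segment-below : ∀ {u v} → u ≼ v → label u < label v → ∃[ t ] (InSegment v t × t ≼ u)
  segment-below {u} {v} u≼v u<v with rootmost (λ w → label w <? label v) (here {u = u}) u<v
  ... | t , rm@(t≼u , t<v , _) = t , (≼-trans t≼u u≼v , rootmost-below-is-TDM rm , t<v) , t≼u

  top-exists : ∀ {u v} → InSegment v u → ∃ (IsTop v)
  top-exists {v = v} (u≼v , _ , u<v) with rootmost (λ w → label w <? label v) u≼v u<v
  ... | t , rm@(t≼v , t<v , least) =
    t , (t≼v , rootmost-below-is-TDM rm , t<v) , λ _ (w≼v , _ , w<v) → least w≼v w<v

  segment⇒¬TDM : ∀ {u v} → InSegment v u → ¬ TDM v
  segment⇒¬TDM (u≼v , _ , u<v) TDM-v = ℤ.<⇒≱ u<v (TDM-v _ u≼v)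

  segment-extend : ∀ {u v w} → InSegment v u → v ≼ w → label u < label w → InSegment w u
  segment-extend (u≼v , TDM-u , _) v≼w u<w = ≼-trans u≼v v≼w , TDM-u , u<w

  -- Stated with _<ᵇ_ so that, for a concrete π, the pairs not in increasing
  -- order are dismissed by absurd patterns.
  contains-of-order : ∀ {m} (π : Vec ℕ (suc m)) → Unique π → (v : Fin (suc m) → Fin n) →
    (∀ i → v (inject₁ i) ≺ v (suc i)) →
    (∀ i j → T (lookup π i <ᵇ lookup π j) → label (v i) < label (v j)) →
    Contains π
  contains-of-order π distinct v chain ordered = v , chain , λ i j → preserves i j , reflects i j
    where
    preserves : ∀ i j → lookup π i <ℕ lookup π j → label (v i) < label (v j)
    preserves i j πi<πj = ordered i j (ℕ.<⇒<ᵇ πi<πj)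

    reflects : ∀ i j → label (v i) < label (v j) → lookup π i <ℕ lookup π j
    reflects i j vi<vj with ℕ.<-cmp (lookup π i) (lookup π j)
    ... | tri< πi<πj _ _ = πi<πj
    ... | tri≈ _ πi≡πj _ with refl ← lookup-injective distinct i j πi≡πj =
      ⊥-elim (ℤ.<-irrefl refl vi<vj)
    ... | tri> _ _ πj<πi = ⊥-elim (ℤ.<-asym vi<vj (preserves j i πj<πi))

  contains-132 : ∀ {x y z} → x ≺ y → y ≺ z → label x < label z → label z < label y →
    Contains p132
  contains-132 {x} {y} {z} x≺y y≺z x<z z<y =
    contains-of-order p132 (from-yes (allPairs? (λ k l → ¬? (k ≟ l)) p132)) v chain ordered
    where
    v : Fin 3 → Fin n
    v = lookup (x ∷ y ∷ z ∷ [])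

    chain : ∀ i → v (inject₁ i) ≺ v (suc i)
    chain zero = x≺y
    chain (suc zero) = y≺z

    ordered : ∀ i j → T (lookup p132 i <ᵇ lookup p132 j) → label (v i) < label (v j)
    ordered zero (suc zero) _ = ℤ.<-trans x<z z<y
    ordered zero (suc (suc zero)) _ = x<z
    ordered (suc (suc zero)) (suc zero) _ = z<y
    ordered (suc zero) zero ()
    ordered (suc zero) (suc (suc zero)) ()
    ordered (suc (suc zero)) zero ()
    ordered (suc (suc zero)) (suc (suc zero)) ()

  contains-3124 : ∀ {a b c d} → a ≺ b → b ≺ c → c ≺ d →
    label b < label c → label c < label a → label a < label d → Contains p3124
  contains-3124 {a} {b} {c} {d} a≺b b≺c c≺d b<c c<a a<d =
    contains-of-order p3124 (from-yes (allPairs? (λ k l → ¬? (k ≟ l)) p3124)) v chain ordered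
    where
    v : Fin 4 → Fin n
    v = lookup (a ∷ b ∷ c ∷ d ∷ [])

    chain : ∀ i → v (inject₁ i) ≺ v (suc i)
    chain zero = a≺b
    chain (suc zero) = b≺c
    chain (suc (suc zero)) = c≺d

    ordered : ∀ i j → T (lookup p3124 i <ᵇ lookup p3124 j) → label (v i) < label (v j)
    ordered zero (suc (suc (suc zero))) _ = a<d
    ordered (suc zero) zero _ = ℤ.<-trans b<c c<a
    ordered (suc zero) (suc (suc zero)) _ = b<c
    ordered (suc zero) (suc (suc (suc zero))) _ = ℤ.<-trans (ℤ.<-trans b<c c<a) a<d
    ordered (suc (suc zero)) zero _ = c<a
    ordered (suc (suc zero)) (suc (suc (suc zero))) _ = ℤ.<-trans c<a a<d
    ordered zero (suc zero) ()
    ordered zero (suc (suc zero)) ()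
    ordered (suc (suc zero)) (suc zero) ()
    ordered (suc (suc zero)) (suc (suc zero)) ()
    ordered (suc (suc (suc zero))) zero ()
    ordered (suc (suc (suc zero))) (suc zero) ()
    ordered (suc (suc (suc zero))) (suc (suc zero)) ()
    ordered (suc (suc (suc zero))) (suc (suc (suc zero))) ()

  ≢⇒label-<⊎> : ∀ {u v} → u ≢ v → label u < label v ⊎ label v < label u
  ≢⇒label-<⊎> {u} {v} u≢v with ℤ.<-cmp (label u) (label v)
  ... | tri< u<v _ _ = inj₁ u<v
  ... | tri≈ _ u≡v _ = ⊥-elim (u≢v (label-inj u≡v))
  ... | tri> _ _ v<u = inj₂ v<u

  TDM≢¬TDM : ∀ {u v} → TDM u → ¬ TDM v → u ≢ v
  TDM≢¬TDM TDM-u ¬TDM-v refl = ¬TDM-v TDM-u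

  label-<⇒≢ : ∀ {u v} → label u < label v → u ≢ v
  label-<⇒≢ u<v refl = ℤ.<-irrefl refl u<v

  label->⇒≢ : ∀ {u v} → label v < label u → u ≢ v
  label->⇒≢ v<u refl = ℤ.<-irrefl refl v<u

  tops-agree-by-132 : Avoids F p132 → ∀ {v w t t′} → v ≼ w → IsTop v t → IsTop w t′ →
    t ≼ t′ → t′ ≼ v → t ≡ t′
  tops-agree-by-132 avoid {v} {w} {t} {t′} v≼w ((t≼v , TDM-t , t<v) , _)
    (t′∈w@(_ , _ , t′<w) , least′) t≼t′ t′≼v
    with ≢⇒label-<⊎> (TDM≢¬TDM TDM-t (segment⇒¬TDM t′∈w))
  ... | inj₁ t<w = ≼-antisym t≼t′ (least′ _ (≼-trans t≼v v≼w , TDM-t , t<w))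
  ... | inj₂ w<t = ⊥-elim (avoid (contains-132 t′≺v v≺w t′<w w<v))
    where
    w<v : label w < label v
    w<v = ℤ.<-trans w<t t<v
    t′≺v : t′ ≺ v
    t′≺v = ≼∧≢⇒≺ t′≼v (label-<⇒≢ (ℤ.<-trans t′<w w<v))
    v≺w : v ≺ w
    v≺w = ≼∧≢⇒≺ v≼w (label->⇒≢ w<v)

  tops-agree-by-3124 : Avoids F p3124 → ∀ {v w t t′} → v ≼ w → IsTop v t → IsTop w t′ →
    t′ ≼ t → t ≡ t′
  tops-agree-by-3124 avoid {v} {w} {t} {t′} v≼w (t∈v@(t≼v , _ , t<v) , least)
    ((_ , TDM-t′ , t′<w) , _) t′≼t
    with ≢⇒label-<⊎> (TDM≢¬TDM TDM-t′ (segment⇒¬TDM t∈v))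
  ... | inj₁ t′<v = ≼-antisym (least _ (≼-trans t′≼t t≼v , TDM-t′ , t′<v)) t′≼t
  ... | inj₂ v<t′ = ⊥-elim (avoid (contains-3124 t′≺t t≺v v≺w t<v v<t′ t′<w))
    where
    t′≺t : t′ ≺ t
    t′≺t = ≼∧≢⇒≺ t′≼t (label->⇒≢ (ℤ.<-trans t<v v<t′))
    t≺v : t ≺ v
    t≺v = ≼∧≢⇒≺ t≼v (label-<⇒≢ t<v)
    v≺w : v ≺ w
    v≺w = ≼∧≢⇒≺ v≼w (label-<⇒≢ (ℤ.<-trans v<t′ t′<w))

  nested-tops-agree : Avoids F p132 → Avoids F p3124 → ∀ {u v w t t′} → v ≼ w →
    InSegment v u → InSegment w u → IsTop v t → IsTop w t′ → t ≡ t′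
  nested-tops-agree avoid132 avoid3124 {u} v≼w u∈v@(u≼v , _) u∈w
    top-v@(_ , least-v) top-w@(_ , least-w)
    with ancestors-comparable (least-v u u∈v) (least-w u u∈w)
  ... | inj₁ t≼t′ = tops-agree-by-132 avoid132 v≼w top-v top-w t≼t′ (≼-trans (least-w u u∈w) u≼v)
  ... | inj₂ t′≼t = tops-agree-by-3124 avoid3124 v≼w top-v top-w t′≼t

  avoidance⇒P₂ : Avoids F p132 → Avoids F p3124 → P₂ F
  avoidance⇒P₂ avoid132 avoid3124 v w (inj₁ v≼w) _ _ (u , u∈v , u∈w) t t′ top-v top-w =
    nested-tops-agree avoid132 avoid3124 v≼w u∈v u∈w top-v top-w
  avoidance⇒P₂ avoid132 avoid3124 v w (inj₂ w≼v) _ _ (u , u∈v , u∈w) t t′ top-v top-w =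
    sym (nested-tops-agree avoid132 avoid3124 w≼v u∈w u∈v top-w top-v)

  P₂⇒132-from-3124 : P₂ F → ∀ {a b c d} → a ≺ b → b ≺ c → c ≺ d →
    label b < label c → label c < label a → label a < label d → Contains p132
  P₂⇒132-from-3124 p₂ {a} {b} {c} {d} a≺b b≺c c≺d b<c c<a a<d
    with segment-below (≺⇒≼ b≺c) b<c | segment-below (≺⇒≼ (≺-trans (≺-trans a≺b b≺c) c≺d)) a<d
  ... | m , m∈c@(_ , _ , m<c) , _ | m′ , m′∈d , m′≼a
    with top-exists m∈c | top-exists m′∈d
  ... | T , top-c@((_ , _ , T<c) , _) | T′ , top-d@(_ , least-d) =
    contains-132 T≺a (≺-trans a≺b b≺c) T<c c<a
    where
    m∈d : InSegment d m
    m∈d = segment-extend m∈c (≺⇒≼ c≺d) (ℤ.<-trans m<c (ℤ.<-trans c<a a<d))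
    T≡T′ : T ≡ T′
    T≡T′ = p₂ c d (inj₁ (≺⇒≼ c≺d)) (segment⇒¬TDM m∈c) (segment⇒¬TDM m∈d)
                  (m , m∈c , m∈d) T T′ top-c top-d
    T≼a : T ≼ a
    T≼a = subst (_≼ a) (sym T≡T′) (≼-trans (least-d m′ m′∈d) m′≼a)
    T≺a : T ≺ a
    T≺a = ≼∧≢⇒≺ T≼a (label-<⇒≢ (ℤ.<-trans T<c c<a))

  P₂⇒avoids-3124 : Avoids F p132 → P₂ F → Avoids F p3124
  P₂⇒avoids-3124 avoid132 p₂ (v , chain , order) =
    avoid132 (P₂⇒132-from-3124 p₂ (chain zero) (chain (suc zero)) (chain (suc (suc zero)))
                                  (consecutive (suc zero) (suc (suc zero)) refl)
                                  (consecutive (suc (suc zero)) zero refl)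
                                  (consecutive zero (suc (suc (suc zero))) refl))
    where
    consecutive : ∀ i j → suc (lookup p3124 i) ≡ lookup p3124 j → label (v i) < label (v j)
    consecutive i j πj≡1+πi = proj₁ (order i j) (ℕ.≤-reflexive πj≡1+πi)

lemma3p16 : ∀ (n : ℕ) (F : Forest n) → Avoids F p132 →
    (Avoids F p3124 ⇔ P₂ F)
lemma3p16 n F avoid132 = mk⇔ (avoidance⇒P₂ F avoid132) (P₂⇒avoids-3124 F avoid132)
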